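{- If a natural number $m$ appears twice in $(a(n))_{n\ge0}$, i.e., $a(x)=a(y)=m$ with $x<y$, then $y=x+1$.
   Context: Fibonacci numbers: $F_0=0$, $F_1=1$, $F_n=F_{n-1}+F_{n-2}$. The sequence $(a(n))_{n\geq 0}$ (OEIS A105774) is defined by $a(n)=n$ for $n\le 1$, and $a(n)=F_{j+1}-a(n-F_j)$ if $F_j<n\le F_{j+1}$ with $j\ge 2$. -}

module Defs where

open import Data.Nat using (ℕ; zero; suc; _+_; _∸_; _≤ᵇ_)
open import Data.Bool using (if_then_else_)

fib : ℕ → ℕ
fib zero = zero
fib (suc zero) = suc zero
fib (suc (suc n)) = fib (suc n) + fib n

-- findJ fuel j n : the least j' ≥ j with n ≤ F (j'+1) (search bounded by fuel).
-- Starting from j = 2 with n ≥ 2 this yields the unique j ≥ 2 with F j < n ≤ F (j+1).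
findJ : ℕ → ℕ → ℕ → ℕ
findJ zero j n = j
findJ (suc f) j n = if n ≤ᵇ fib (suc j) then j else findJ f (suc j) n

-- fuelled version of the recursion; fuel n suffices since each step
-- strictly decreases the argument (F j ≥ 1 for j ≥ 2)
aF : ℕ → ℕ → ℕ
aF zero n = zero
aF (suc f) zero = zero
aF (suc f) (suc zero) = suc zero
aF (suc f) (suc (suc m)) =
  let n = suc (suc m)
      j = findJ n 2 n
  in fib (suc j) ∸ aF f (n ∸ fib j)

-- OEIS A105774: a n = n for n ≤ 1, a n = F (j+1) - a (n - F j) for F j < n ≤ F (j+1), j ≥ 2
a : ℕ → ℕ
a n = aF n n

-- For F j < n ≤ F (j+1) the remainder r = n − F j lies in [1, F (j−1)], and inductively so
-- does a r; hence a n = F (j+1) − a r lies in [F j, F (j+1)).  So equal values a x = a y with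
-- x, y ≥ 2 come from the same block, their remainders x − F j < y − F j again have equal
-- values, and induction reduces everything to x ≤ 1: the value a 0 = 0 never recurs, and
-- a n = 1 with n ≥ 2 forces n = 2.

module Submission where

open import Defs
open import Data.Nat using (ℕ; _<_; _+_)
open import Relation.Binary.PropositionalEquality using (_≡_)
open import Data.Bool.Base using (true; false; T)
open import Data.Nat.Base
open import Data.Nat.Induction using (<-rec)
open import Data.Nat.Properties
open import Data.Product using (∃-syntax; _×_; _,_; proj₁; proj₂)
open import Relation.Nullary using (contradiction)
open import Relation.Binary.PropositionalEquality
  using (refl; sym; trans; cong; subst; module ≡-Reasoning)

fib-pos : ∀ n → 1 ≤ fib (suc n)
fib-pos zero    = ≤-refl
fib-pos (suc n) = ≤-trans (fib-pos n) (m≤m+n (fib (suc n)) (fib n))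

fib-≤-suc : ∀ n → fib n ≤ fib (suc n)
fib-≤-suc zero    = z≤n
fib-≤-suc (suc n) = m≤m+n (fib (suc n)) (fib n)

fib-mono-≤′ : ∀ {i j} → i ≤′ j → fib i ≤ fib j
fib-mono-≤′ ≤′-refl                 = ≤-refl
fib-mono-≤′ {j = suc j} (≤′-step p) = ≤-trans (fib-mono-≤′ p) (fib-≤-suc j)

fib-mono-≤ : ∀ {i j} → i ≤ j → fib i ≤ fib j
fib-mono-≤ p = fib-mono-≤′ (≤⇒≤′ p)

fib-cancel-< : ∀ {i j} → fib i < fib j → i < j
fib-cancel-< fi<fj = ≰⇒> λ j≤i → <⇒≱ fi<fj (fib-mono-≤ j≤i)

n<fib[2+n] : ∀ n → n < fib (2 + n)
n<fib[2+n] zero    = ≤-refl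
n<fib[2+n] (suc n) = begin
  2 + n              ≤⟨ s≤s (n<fib[2+n] n) ⟩
  1 + fib (2 + n)    ≡⟨ +-comm 1 (fib (2 + n)) ⟩
  fib (2 + n) + 1    ≤⟨ +-monoʳ-≤ (fib (2 + n)) (fib-pos n) ⟩
  fib (3 + n)        ∎
  where open ≤-Reasoning

fib-range-unique : ∀ {i j v} → fib i ≤ v → v < fib (suc i) →
                   fib j ≤ v → v < fib (suc j) → i ≡ j
fib-range-unique lo hi lo′ hi′ = ≤-antisym
  (s≤s⁻¹ (fib-cancel-< (≤-<-trans lo hi′)))
  (s≤s⁻¹ (fib-cancel-< (≤-<-trans lo′ hi)))

∸-between : ∀ m n {o} → 1 ≤ o → o ≤ n → m ≤ m + n ∸ o × m + n ∸ o < m + n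
∸-between m n 1≤o o≤n =
    ≤-trans (≤-reflexive (sym (m+n∸n≡m m n))) (∸-monoʳ-≤ (m + n) o≤n)
  , ∸-monoʳ-< 1≤o (≤-trans o≤n (m≤n+m n m))

∸-cancelʳ-suc : ∀ {m n o} → o ≤ m → o ≤ n → n ∸ o ≡ suc (m ∸ o) → n ≡ suc m
∸-cancelʳ-suc {m} {n} {o} o≤m o≤n eq = begin
  n                ≡⟨ sym (m∸n+n≡m o≤n) ⟩
  n ∸ o + o        ≡⟨ cong (_+ o) eq ⟩
  suc (m ∸ o + o)  ≡⟨ cong suc (m∸n+n≡m o≤m) ⟩
  suc m            ∎
  where open ≡-Reasoning

record InBlock (j n : ℕ) : Set where
  constructor block
  field
    lower : fib j < n
    upper : n ≤ fib (suc j)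

open InBlock

remainder-pos : ∀ {j n} → InBlock j n → 1 ≤ n ∸ fib j
remainder-pos (block lo _) = m<n⇒0<n∸m lo

remainder-< : ∀ {j n} → InBlock (suc j) n → n ∸ fib (suc j) < n
remainder-< {j} (block lo _) = ∸-monoʳ-< (fib-pos j) (<⇒≤ lo)

remainder-≤ : ∀ {j n} → InBlock (suc j) n → n ∸ fib (suc j) ≤ fib j
remainder-≤ {j} {n} (block _ up) = m≤n+o⇒m∸n≤o n (fib (suc j)) up

findJ-≥ : ∀ f j n → j ≤ findJ f j n
findJ-≥ zero    j n = ≤-refl
findJ-≥ (suc f) j n with n ≤ᵇ fib (suc j)
... | true  = ≤-refl
... | false = ≤-trans (n≤1+n j) (findJ-≥ f (suc j) n)

findJ-inBlock : ∀ f j n → fib j < n → n ≤ fib (suc (f + j)) → InBlock (findJ f j n) n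
findJ-inBlock zero    j n lo up = block lo up
findJ-inBlock (suc f) j n lo up with n ≤ᵇ fib (suc j) in eq
... | true  = block lo (≤ᵇ⇒≤ n (fib (suc j)) (subst T (sym eq) _))
... | false = findJ-inBlock f (suc j) n
  (≰⇒> λ n≤ → subst T eq (≤⇒≤ᵇ n≤))
  (subst (λ k → n ≤ fib (suc k)) (sym (+-suc f j)) up)

blockIndex : ℕ → ℕ
blockIndex n = findJ n 2 n

blockIndex-inBlock : ∀ n → 1 < n → InBlock (blockIndex n) n
blockIndex-inBlock n 1<n = findJ-inBlock n 2 n 1<n (begin
  n                  ≤⟨ <⇒≤ (n<fib[2+n] n) ⟩
  fib (2 + n)        ≤⟨ fib-mono-≤ (≤-trans (≤-reflexive (+-comm 2 n)) (n≤1+n (n + 2))) ⟩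
  fib (suc (n + 2))  ∎)
  where open ≤-Reasoning

blockIndex-remainder-≤ : ∀ m → 2 + m ∸ fib (blockIndex (2 + m)) ≤ suc m
blockIndex-remainder-≤ m = ∸-monoʳ-≤ (2 + m) (fib-mono-≤ {2} (findJ-≥ (2 + m) 2 (2 + m)))

aF-fuel-irrelevant : ∀ f g n → n ≤ f → n ≤ g → aF f n ≡ aF g n
aF-fuel-irrelevant zero    zero    _             z≤n _   = refl
aF-fuel-irrelevant zero    (suc g) _             z≤n _   = refl
aF-fuel-irrelevant (suc f) zero    _             _   z≤n = refl
aF-fuel-irrelevant (suc f) (suc g) zero          _   _   = refl
aF-fuel-irrelevant (suc f) (suc g) (suc zero)    _   _   = refl
aF-fuel-irrelevant (suc f) (suc g) (suc (suc m)) (s≤s n≤f) (s≤s n≤g) =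
  cong (fib (suc j) ∸_) (aF-fuel-irrelevant f g (2 + m ∸ fib j)
    (≤-trans (blockIndex-remainder-≤ m) n≤f) (≤-trans (blockIndex-remainder-≤ m) n≤g))
  where j = blockIndex (2 + m)

a-unfold : ∀ m → let j = blockIndex (2 + m) in a (2 + m) ≡ fib (suc j) ∸ a (2 + m ∸ fib j)
a-unfold m = cong (fib (suc j) ∸_) (aF-fuel-irrelevant (suc m) r r (blockIndex-remainder-≤ m) ≤-refl)
  where
    j = blockIndex (2 + m)
    r = 2 + m ∸ fib j

-- The paper's block index is suc j here, so that fib (suc (suc j)) = fib (suc j) + fib j
-- unfolds definitionally.
record Decomposition (j n : ℕ) : Set where
  constructor decomposition
  field
    inBlock : InBlock (suc j) n
    unfolds : a n ≡ fib (2 + j) ∸ a (n ∸ fib (suc j))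

open Decomposition

a-decompose : ∀ n → 1 < n → ∃[ j ] Decomposition j n
a-decompose (suc zero) (s≤s ())
a-decompose n@(suc (suc m)) 1<n = shift (blockIndex n) (blockIndex-inBlock n 1<n) (a-unfold m)
  where
    shift : ∀ j → InBlock j n → a n ≡ fib (suc j) ∸ a (n ∸ fib j) → ∃[ j′ ] Decomposition j′ n
    shift zero    (block _ (s≤s ())) _
    shift (suc j) b                  eq = j , decomposition b eq

Bounded : ℕ → Set
Bounded n = 1 ≤ a n × (∀ k → n ≤ fib k → a n ≤ fib k)

bounded-remainder⇒a-range : ∀ {j n} (d : Decomposition j n) → Bounded (n ∸ fib (suc j)) →
                            fib (suc j) ≤ a n × a n < fib (2 + j)
bounded-remainder⇒a-range {j} d (pos , bound) rewrite unfolds d =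
  ∸-between (fib (suc j)) (fib j) pos (bound j (remainder-≤ (inBlock d)))

a-bounded : ∀ n → 1 ≤ n → Bounded n
a-bounded = <-rec _ step
  where
    step : ∀ n → (∀ {r} → r < n → 1 ≤ r → Bounded r) → 1 ≤ n → Bounded n
    step (suc zero)      _  _ = ≤-refl , λ _ 1≤fk → 1≤fk
    step n@(suc (suc _)) ih _ with a-decompose n (s≤s (s≤s z≤n))
    ... | j , d = ≤-trans (fib-pos j) lo , λ k n≤fk →
        <⇒≤ (<-≤-trans hi (fib-mono-≤ {2 + j} {k} (fib-cancel-< (<-≤-trans (lower b) n≤fk))))
      where
        b = inBlock d
        range = bounded-remainder⇒a-range d (ih (remainder-< b) (remainder-pos b))
        lo = proj₁ range
        hi = proj₂ range

a-pos : ∀ {n} → 1 ≤ n → 1 ≤ a n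
a-pos {n} 1≤n = proj₁ (a-bounded n 1≤n)

a-≤-fib : ∀ {n} k → n ≤ fib k → 1 ≤ n → a n ≤ fib k
a-≤-fib {n} k n≤fk 1≤n = proj₂ (a-bounded n 1≤n) k n≤fk

a-range : ∀ {j n} → Decomposition j n → fib (suc j) ≤ a n × a n < fib (2 + j)
a-range d = bounded-remainder⇒a-range d (a-bounded _ (remainder-pos (inBlock d)))

a[n]≡1⇒n≡2 : ∀ {n} → 1 < n → a n ≡ 1 → n ≡ 2
a[n]≡1⇒n≡2 {n} 1<n an≡1 with a-decompose n 1<n
... | j , d = ≤-antisym (≤-trans (upper (inBlock d)) (fib-mono-≤ (s≤s (s≤s j≤1)))) 1<n
  where
    j≤1 : j ≤ 1
    j≤1 = s≤s⁻¹ (s≤s⁻¹ (fib-cancel-< (≤-<-trans (proj₁ (a-range d)) (s≤s (≤-reflexive an≡1)))))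

a-cancel-index : ∀ {i j x y} → Decomposition i x → Decomposition j y → a x ≡ a y → i ≡ j
a-cancel-index dx dy ax≡ay = suc-injective (fib-range-unique
  (subst (_ ≤_) ax≡ay (proj₁ (a-range dx))) (subst (_< _) ax≡ay (proj₂ (a-range dx)))
  (proj₁ (a-range dy)) (proj₂ (a-range dy)))

a-cancel-remainder : ∀ {j x y} → Decomposition j x → Decomposition j y →
                     a x ≡ a y → a (x ∸ fib (suc j)) ≡ a (y ∸ fib (suc j))
a-cancel-remainder {j} dx dy ax≡ay =
  ∸-cancelˡ-≡ (remainder-value-≤ dx) (remainder-value-≤ dy) (trans (sym (unfolds dx)) (trans ax≡ay (unfolds dy)))
  where
    remainder-value-≤ : ∀ {n} → Decomposition j n → a (n ∸ fib (suc j)) ≤ fib (2 + j)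
    remainder-value-≤ {n} d =
      a-≤-fib (2 + j) (≤-trans (m∸n≤m n (fib (suc j))) (upper (inBlock d))) (remainder-pos (inBlock d))

a-repeats-adjacent : ∀ y x → a x ≡ a y → x < y → y ≡ suc x
a-repeats-adjacent = <-rec _ step
  where
    step : ∀ y → (∀ {y′} → y′ < y → ∀ x → a x ≡ a y′ → x < y′ → y′ ≡ suc x) →
           ∀ x → a x ≡ a y → x < y → y ≡ suc x
    step y _  zero            a0≡ay 0<y = contradiction (a-pos 0<y) (<-irrefl a0≡ay)
    step y _  (suc zero)      a1≡ay 1<y = a[n]≡1⇒n≡2 1<y (sym a1≡ay)
    step y ih x@(suc (suc _)) ax≡ay x<y
      with a-decompose x (s≤s (s≤s z≤n)) | a-decompose y (<-trans (s≤s (s≤s z≤n)) x<y)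
    ... | i , dx | j , dy with a-cancel-index dx dy ax≡ay
    ... | refl = ∸-cancelʳ-suc (<⇒≤ (lower (inBlock dx))) (<⇒≤ (lower (inBlock dy)))
      (ih (remainder-< (inBlock dy)) (x ∸ fib (suc i))
          (a-cancel-remainder dx dy ax≡ay)
          (∸-monoˡ-< x<y (<⇒≤ (lower (inBlock dx)))))

proposition2 : (m x y : ℕ) → a x ≡ m → a y ≡ m → x < y → y ≡ x + 1
proposition2 m x y ax≡m ay≡m x<y =
  trans (a-repeats-adjacent y x (trans ax≡m (sym ay≡m)) x<y) (+-comm 1 x)
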